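{- Let $A$ and $G$ be graphs with complementarity, with $G$ modular and $p\colon G\to A$ an adequate morphism of graphs with complementarity, and let $q\colon H\to A$ be a morphism of reflexive graphs. Let $x_1,x_2$ be vertices of $G$ with $x_1\smile x_2$, let $z$ be a vertex of $G$ with $(x_1,x_2)\Vdash^{G} z$, and let $y$ be a vertex of $H$ with $x_2\approx_A y$. Then $z\in\bot^{G}$ if and only if $(x_1,y)\in\bot^{G\otimes_A H}$.
   Context: Reflexive graphs have vertices, edges, source/target maps and identity edges; an edge $e\colon x'\to x$ is read as a transition from $x$ to $x'$. A relation between reflexive graphs is a subgraph of their product; partially functional means each vertex/edge is related to at most one; its domain is the subgraph of related elements. $\Sigma$ is the reflexive graph with one vertex and edges $\mathit{id},\heartsuit$. A graph with complementarity is $(A,A^{W},\Vdash^{A},\ell^{A})$: $A$ a reflexive graph, $A^{W}$ a subgraph, $\Vdash^{A}\colon A\times A\nrightarrow A^{W}$ a relation, $\ell^{A}\colon A^{W}\to\Sigma$ a morphism, with the composite relation $A\times A\nrightarrow A^{W}\to\Sigma$ partially functional and symmetric; $A^{\smile}$ is the domain of $\Vdash^{A}$, $a\smile b$ means $(a,b)\in A^{\smile}$, and $A^{\smile}$ is a graph over $\Sigma$ via $(a,b)\mapsto(a\Downarrow b)$ given by the composite. A morphism of graphs with complementarity $f$ is a morphism of reflexive graphs preserving the closed-world subgraphs, the labellings $\ell$, and the relations $\Vdash$. $G$ is modular iff for all vertices with $(x,y)\Vdash^{G}z$: (1) every edge $e\colon z'\to z$ of $G^{W}$ admits edges $e_x\colon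 x'\to x$, $e_y\colon y'\to y$ with $(e_x,e_y)\Vdash^{G}e$; (2) for all edges $e_x\colon x'\to x$, $e_y\colon y'\to y$ with $e_x\smile e_y$ there is $e\colon z'\to z$ with $(e_x,e_y)\Vdash^{G}e$. For $p\colon G\to A$, $q\colon H\to A$, the blind composition $G\otimes_A H$ is the pullback of $A^{\smile}\hookrightarrow A\times A$ along $p\times q$, a graph over $\Sigma$ via $(g,h)\mapsto p(g)\Downarrow q(h)$. For a graph $K$ over $\Sigma$: $x\Leftarrow x'$ means a path from $x'$ to $x$ with all edges labelled $\mathit{id}$; $x\Leftarrow^{\heartsuit}x'$ means a path from $x'$ to $x$ whose labels with identities deleted are exactly $(\heartsuit)$; $\bot^{K}$ is the set of $x$ such that for all $x'$ with $x\Leftarrow x'$ there is $x''$ with $x'\Leftarrow^{\heartsuit}x''$; $\bot^{G}$ means $\bot^{G^{W}}$ with $G^{W}$ over $\Sigma$ via $\ell^{G}$. For graphs $r\colon K\to B$, $s\colon L\to B$, a weak bisimulation is a relation $R$ on vertices with $R(x,y)\Rightarrow r(x)=s(y)$ such that whenever $R(x,y)$ and $e\colon x'\to x$ is an edge of $K$, there is a path from some $y'$ to $y$ in $L$ with $R(x',y')$ whose image under $s$, with identity edges deleted, equals $(r(e))$ with identity edges deleted, and symmetrically; $\approx_B$ (weak bisimilarity) is the union of all weak bisimulations, used between vertices of different graphs as bisimilarity in the disjoint union. $p\colon G\to A$ is adequate iff (a) each vertex $(x,y)$ of $G^{\smile}$ is weakly bisimilar over $\Sigma$ to the vertex $(x,y)$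 of $G\otimes_A G$, and (b) $x\smile y$ iff $p(x)\smile p(y)$ for all vertices $x,y$ of $G$. -}

module Defs where

open import Data.Unit using (⊤; tt)
open import Data.Product using (Σ; ∃; _×_; _,_; proj₁; proj₂)
open import Data.List using (List; []; _∷_)
open import Data.List.Relation.Unary.All using (All)
open import Relation.Nullary using (¬_)
open import Relation.Binary.PropositionalEquality using (_≡_)
open import Function.Bundles using (_⇔_)

-- Reflexive graphs.  An edge e with src e ≡ x' and tgt e ≡ x is an edge
-- e : x' → x, read as a transition from x to x'.

record RGraph : Set₁ where
  field
    V     : Set
    E     : Set
    src   : E → V
    tgt   : E → V
    ide   : V → E
    src-ide : ∀ v → src (ide v) ≡ v
    tgt-ide : ∀ v → tgt (ide v) ≡ v

open RGraph public

record Hom (G H : RGraph) : Set where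
  field
    fV : V G → V H
    fE : E G → E H
    f-src : ∀ e → src H (fE e) ≡ fV (src G e)
    f-tgt : ∀ e → tgt H (fE e) ≡ fV (tgt G e)
    f-ide : ∀ v → fE (ide G v) ≡ ide H (fV v)

open Hom public

_⊗ᴿ_ : RGraph → RGraph → RGraph
G ⊗ᴿ H = record
  { V = V G × V H
  ; E = E G × E H
  ; src = λ { (a , b) → src G a , src H b }
  ; tgt = λ { (a , b) → tgt G a , tgt H b }
  ; ide = λ { (a , b) → ide G a , ide H b }
  ; src-ide = λ { (a , b) → cong₂' (src-ide G a) (src-ide H b) }
  ; tgt-ide = λ { (a , b) → cong₂' (tgt-ide G a) (tgt-ide H b) }
  }
  where
  open import Relation.Binary.PropositionalEquality using (refl)
  cong₂' : ∀ {X Y : Set} {x x' : X} {y y' : Y} → x ≡ x' → y ≡ y' → (x , y) ≡ (x' , y')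
  cong₂' refl refl = refl

data Label : Set where
  idL : Label
  ♥   : Label

ΣG : RGraph
ΣG = record
  { V = ⊤ ; E = Label ; src = λ _ → tt ; tgt = λ _ → tt ; ide = λ _ → idL
  ; src-ide = λ _ → Relation.Binary.PropositionalEquality.refl
  ; tgt-ide = λ _ → Relation.Binary.PropositionalEquality.refl }
  where import Relation.Binary.PropositionalEquality

-- Subgraphs are given by predicates on vertices/edges (closed under
-- source, target and identities).  The relation ⊩ : A × A ⇸ A^W is a
-- subgraph of (A × A) × A^W, given by predicates RV (vertices) and RE
-- (edges); RV a b z means (a , b) ⊩ z.

record GC : Set₁ where
  field
    Gr : RGraph
  field
    -- closed-world subgraph A^W
    WV : V Gr → Set
    WE : E Gr → Set
    WE-src : ∀ {e} → WE e → WV (src Gr e)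
    WE-tgt : ∀ {e} → WE e → WV (tgt Gr e)
    WV-ide : ∀ {v} → WV v → WE (ide Gr v)
    RV : V Gr → V Gr → V Gr → Set
    RE : E Gr → E Gr → E Gr → Set
    RV-W : ∀ {a b z} → RV a b z → WV z
    RE-W : ∀ {a b e} → RE a b e → WE e
    RE-src : ∀ {a b e} → RE a b e → RV (src Gr a) (src Gr b) (src Gr e)
    RE-tgt : ∀ {a b e} → RE a b e → RV (tgt Gr a) (tgt Gr b) (tgt Gr e)
    RV-ide : ∀ {a b z} → RV a b z → RE (ide Gr a) (ide Gr b) (ide Gr z)
    -- the labelling ℓ : A^W → Σ, a morphism of reflexive graphs
    -- (on vertices it is trivial; on edges it sends identities to id)
    ℓ     : (e : E Gr) → WE e → Label
    ℓ-irr : ∀ e (w w' : WE e) → ℓ e w ≡ ℓ e w'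
    ℓ-ide : ∀ v (w : WE (ide Gr v)) → ℓ (ide Gr v) w ≡ idL
    -- the composite relation A × A ⇸ A^W → Σ is partially functional
    -- (on vertices this is automatic, Σ having one vertex) ...
    ⇓-functional : ∀ {a b e e'} → RE a b e → RE a b e' →
                   (w : WE e) (w' : WE e') → ℓ e w ≡ ℓ e' w'
    ⇓-symV : ∀ {a b z} → RV a b z → ∃ λ z' → RV b a z'
    ⇓-symE : ∀ {a b e} → RE a b e → (w : WE e) →
             Σ (E Gr) λ e' → Σ (WE e') λ w' → RE b a e' × ℓ e' w' ≡ ℓ e w

open GC public

Compl : (A : GC) → V (Gr A) → V (Gr A) → Set
Compl A a b = ∃ λ z → RV A a b z

ComplE : (A : GC) → E (Gr A) → E (Gr A) → Set
ComplE A a b = ∃ λ e → RE A a b e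

⇓ : (A : GC) {a b : E (Gr A)} → ComplE A a b → Label
⇓ A (e , r) = ℓ A e (RE-W A r)

record GCHom (G A : GC) : Set where
  field
    hom : Hom (Gr G) (Gr A)
    pres-WV : ∀ {v} → WV G v → WV A (fV hom v)
    pres-WE : ∀ {e} → WE G e → WE A (fE hom e)
    pres-ℓ  : ∀ e (w : WE G e) → ℓ A (fE hom e) (pres-WE w) ≡ ℓ G e w
    pres-RV : ∀ {a b z} → RV G a b z → RV A (fV hom a) (fV hom b) (fV hom z)
    pres-RE : ∀ {a b e} → RE G a b e → RE A (fE hom a) (fE hom b) (fE hom e)

open GCHom public

record Modular (G : GC) : Set where
  field
    mod₁ : ∀ {x y z} → RV G x y z →
           ∀ e → WE G e → tgt (Gr G) e ≡ z →
           Σ (E (Gr G)) λ ex → Σ (E (Gr G)) λ ey →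
             tgt (Gr G) ex ≡ x × tgt (Gr G) ey ≡ y × RE G ex ey e
    mod₂ : ∀ {x y z} → RV G x y z →
           ∀ ex ey → tgt (Gr G) ex ≡ x → tgt (Gr G) ey ≡ y →
           ComplE G ex ey →
           Σ (E (Gr G)) λ e → tgt (Gr G) e ≡ z × RE G ex ey e

-- Graphs over B, possibly given as a subgraph (predicates VK, EK) of an
-- ambient reflexive graph K, with the map to B defined on the subgraph.

record Over (B : RGraph) : Set₁ where
  field
    K   : RGraph
    VK  : V K → Set
    EK  : E K → Set
    lV  : (x : V K) → VK x → V B
    lE  : (e : E K) → EK e → E B

open Over public

-- Paths from x' to x in (the subgraph of) K, with their list of labels
-- in B (listed starting from x').
data Path {B : RGraph} (L : Over B) : V (K L) → V (K L) → List (E B) → Set where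
  nil  : ∀ {x} → Path L x x []
  step : ∀ {x' x'' x ls} (e : E (K L)) (pe : EK L e) →
         src (K L) e ≡ x' → tgt (K L) e ≡ x'' →
         Path L x'' x ls → Path L x' x (lE L e pe ∷ ls)

IsIde : (B : RGraph) → E B → Set
IsIde B e = ∃ λ v → e ≡ ide B v

data Del (B : RGraph) : List (E B) → List (E B) → Set where
  []   : Del B [] []
  drop : ∀ {e xs ys} → IsIde B e → Del B xs ys → Del B (e ∷ xs) ys
  keep : ∀ {e xs ys} → ¬ IsIde B e → Del B xs ys → Del B (e ∷ xs) (e ∷ ys)

SameModId : (B : RGraph) → List (E B) → List (E B) → Set
SameModId B xs ys = Σ (List (E B)) λ zs → Del B xs zs × Del B ys zs

record IsWeakBisim {B : RGraph} (KK LL : Over B)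
       (R : V (K KK) → V (K LL) → Set) : Set where
  field
    vert : ∀ {x y} → R x y →
           Σ (VK KK x) λ px → Σ (VK LL y) λ py → lV KK x px ≡ lV LL y py
    forth : ∀ {x y x'} → R x y → (e : E (K KK)) (pe : EK KK e) →
            src (K KK) e ≡ x' → tgt (K KK) e ≡ x →
            Σ (V (K LL)) λ y' → Σ (List (E B)) λ ls →
              Path LL y' y ls × R x' y' × SameModId B ls (lE KK e pe ∷ [])
    back  : ∀ {x y y'} → R x y → (e : E (K LL)) (pe : EK LL e) →
            src (K LL) e ≡ y' → tgt (K LL) e ≡ y →
            Σ (V (K KK)) λ x' → Σ (List (E B)) λ ls →
              Path KK x' x ls × R x' y' × SameModId B ls (lE LL e pe ∷ [])

WeakBisimilar : {B : RGraph} (KK LL : Over B) → V (K KK) → V (K LL) → Set₁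
WeakBisimilar KK LL x y =
  Σ (V (K KK) → V (K LL) → Set) λ R → IsWeakBisim KK LL R × R x y

Arrow : (L : Over ΣG) → V (K L) → V (K L) → Set
Arrow L x x' = Σ (List Label) λ ls → Path L x' x ls × All (λ σ → σ ≡ idL) ls

Arrow♥ : (L : Over ΣG) → V (K L) → V (K L) → Set
Arrow♥ L x x' = Σ (List Label) λ ls → Path L x' x ls × Del ΣG ls (♥ ∷ [])

Bot : (L : Over ΣG) → V (K L) → Set
Bot L x = VK L x × (∀ x' → Arrow L x x' → Σ (V (K L)) λ x'' → Arrow♥ L x' x'')

WGraph : GC → Over ΣG
WGraph G = record { K = Gr G ; VK = WV G ; EK = WE G
                  ; lV = λ _ _ → tt ; lE = ℓ G }

ComplGraph : GC → Over ΣG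
ComplGraph G = record
  { K = Gr G ⊗ᴿ Gr G
  ; VK = λ { (a , b) → Compl G a b }
  ; EK = λ { (a , b) → ComplE G a b }
  ; lV = λ _ _ → tt
  ; lE = λ { (a , b) c → ⇓ G c } }

-- blind composition G ⊗_A H (pullback of A^⌣ ↪ A × A along p × q),
-- over Σ via (g , h) ↦ p(g) ⇓ q(h)
Blind : {G H : RGraph} (A : GC) → Hom G (Gr A) → Hom H (Gr A) → Over ΣG
Blind {G} {H} A p q = record
  { K = G ⊗ᴿ H
  ; VK = λ { (g , h) → Compl A (fV p g) (fV q h) }
  ; EK = λ { (g , h) → ComplE A (fE p g) (fE q h) }
  ; lV = λ _ _ → tt
  ; lE = λ { (g , h) c → ⇓ A c } }

OverHom : {G B : RGraph} → Hom G B → Over B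
OverHom {G} p = record { K = G ; VK = λ _ → ⊤ ; EK = λ _ → ⊤
                       ; lV = λ x _ → fV p x ; lE = λ e _ → fE p e }

record Adequate (G A : GC) (p : GCHom G A) : Set₁ where
  field
    adeq-a : ∀ x y → Compl G x y →
             WeakBisimilar (ComplGraph G) (Blind A (hom p) (hom p)) (x , y) (x , y)
    adeq-b : ∀ x y → Compl G x y ⇔ Compl A (fV (hom p) x) (fV (hom p) y)

module Submission where

-- The property z ∈ ⊥ of a graph over Σ only depends on the
-- labels of paths up to deleting identities, so it is invariant under weak
-- bisimilarity.  The theorem then follows from a chain of three weak
-- bisimilarities over Σ:
--
--   z ≈ (x₁ , x₂)        in G^W  vs  G^⌣      (modularity: ⊩^G is one)
--   (x₁ , x₂) ≈ (x₁ , x₂) in G^⌣  vs  G ⊗_A G  (adequacy (a))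
--   (x₁ , x₂) ≈ (x₁ , y)  in G ⊗_A G vs G ⊗_A H (blind composition
--                        respects weak bisimilarity of the second factor)

open import Defs
open import Data.Product using (Σ; _×_; _,_; proj₁; proj₂)
open import Data.Unit using (tt)
open import Data.Empty using (⊥-elim)
open import Data.List using (List; []; _∷_; _++_)
open import Data.List.Properties using (++-identityʳ)
open import Data.List.Relation.Unary.All using (All; []; _∷_)
open import Relation.Binary.PropositionalEquality
open import Function.Bundles using (_⇔_; mk⇔; Equivalence)
import Function.Properties.Equivalence as ⇔

norm : List Label → List Label
norm [] = []
norm (idL ∷ xs) = norm xs
norm (♥ ∷ xs) = ♥ ∷ norm xs

norm-++ : ∀ xs ys → norm (xs ++ ys) ≡ norm xs ++ norm ys
norm-++ [] ys = refl
norm-++ (idL ∷ xs) ys = norm-++ xs ys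
norm-++ (♥ ∷ xs) ys = cong (♥ ∷_) (norm-++ xs ys)

del-norm : ∀ xs → Del ΣG xs (norm xs)
del-norm [] = []
del-norm (idL ∷ xs) = drop (tt , refl) (del-norm xs)
del-norm (♥ ∷ xs) = keep (λ { (_ , ()) }) (del-norm xs)

norm-del : ∀ {xs ys} → Del ΣG xs ys → norm xs ≡ ys
norm-del [] = refl
norm-del (drop {idL} _ d) = norm-del d
norm-del (drop {♥} (_ , ()) d)
norm-del (keep {idL} ¬id d) = ⊥-elim (¬id (tt , refl))
norm-del (keep {♥} _ d) = cong (♥ ∷_) (norm-del d)

same⇒norm : ∀ {xs ys} → SameModId ΣG xs ys → norm xs ≡ norm ys
same⇒norm (zs , d₁ , d₂) = trans (norm-del d₁) (sym (norm-del d₂))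

norm⇒same : ∀ {xs ys} → norm xs ≡ norm ys → SameModId ΣG xs ys
norm⇒same {xs} {ys} eq = norm ys , subst (Del ΣG xs) eq (del-norm xs) , del-norm ys

all-id⇒norm : ∀ {xs} → All (_≡ idL) xs → norm xs ≡ []
all-id⇒norm [] = refl
all-id⇒norm (refl ∷ ids) = all-id⇒norm ids

norm⇒all-id : ∀ xs → norm xs ≡ [] → All (_≡ idL) xs
norm⇒all-id [] _ = []
norm⇒all-id (idL ∷ xs) eq = refl ∷ norm⇒all-id xs eq
norm⇒all-id (♥ ∷ xs) ()

norm-prefix-id : ∀ {l} xs → l ≡ idL → norm (l ∷ xs) ≡ norm xs
norm-prefix-id xs refl = refl

norm-pad-right : ∀ l ms → norm ms ≡ [] → norm (l ∷ ms) ≡ norm (l ∷ [])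
norm-pad-right l ms eq =
  trans (norm-++ (l ∷ []) ms) (trans (cong (norm (l ∷ []) ++_) eq) (++-identityʳ _))

norm-pad-left : ∀ l ms → norm ms ≡ [] → norm (ms ++ l ∷ []) ≡ norm (l ∷ [])
norm-pad-left l ms eq = trans (norm-++ ms (l ∷ [])) (cong (_++ norm (l ∷ [])) eq)

_++ᴾ_ : ∀ {B} {L : Over B} {x y z ls ms} →
        Path L x y ls → Path L y z ms → Path L x z (ls ++ ms)
nil ++ᴾ Q = Q
step e pe s t P ++ᴾ Q = step e pe s t (P ++ᴾ Q)

converse : ∀ {B} {KK LL : Over B} {R} →
           IsWeakBisim KK LL R → IsWeakBisim LL KK (λ y x → R x y)
converse W = record
  { vert = λ r → let (px , py , eq) = vert r in py , px , sym eq
  ; forth = back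
  ; back = forth }
  where open IsWeakBisim W

≈-sym : ∀ {B} {KK LL : Over B} {x y} → WeakBisimilar KK LL x y → WeakBisimilar LL KK y x
≈-sym (R , W , r) = (λ y x → R x y) , converse W , r

liftPath : ∀ {KK LL : Over ΣG} {R} → IsWeakBisim KK LL R →
           ∀ {x y y' ls} → R x y → Path LL y' y ls →
           Σ (V (K KK)) λ x' → Σ (List Label) λ ms →
             Path KK x' x ms × R x' y' × norm ms ≡ norm ls
liftPath W r nil = _ , [] , nil , r , refl
liftPath {LL = LL} W r (step {ls = ls} e pe s t P) with liftPath W r P
... | x'' , ms , Q , r'' , eq with IsWeakBisim.back W r'' e pe s t
... | x' , ns , Q' , r' , same = x' , ns ++ ms , Q' ++ᴾ Q , r' , (begin
  norm (ns ++ ms)                     ≡⟨ norm-++ ns ms ⟩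
  norm ns ++ norm ms                  ≡⟨ cong₂ _++_ (same⇒norm same) eq ⟩
  norm (lE LL e pe ∷ []) ++ norm ls   ≡⟨ norm-++ (lE LL e pe ∷ []) ls ⟨
  norm (lE LL e pe ∷ ls)              ∎)
  where open ≡-Reasoning

-- ⊥ is invariant under weak bisimulation: an id-path from y is lifted to
-- an id-path from x, the ♥-path guaranteed there is lifted back.
bot-transfer : ∀ {KK LL : Over ΣG} {R} → IsWeakBisim KK LL R →
               ∀ {x y} → R x y → Bot KK x → Bot LL y
bot-transfer {KK} {LL} W r (_ , escape) = proj₁ (proj₂ (IsWeakBisim.vert W r)) , escape'
  where
  escape' : ∀ y' → Arrow LL _ y' → Σ (V (K LL)) λ y'' → Arrow♥ LL y' y''
  escape' y' (ls , P , ids) with liftPath W r P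
  ... | x' , ms , Q , r' , eq with escape x' (ms , Q , norm⇒all-id ms (trans eq (all-id⇒norm ids)))
  ... | x'' , ns , Q'' , d with liftPath (converse W) r' Q''
  ... | y'' , ks , P'' , _ , eq' =
    y'' , ks , P'' , subst (Del ΣG ks) (trans eq' (norm-del d)) (del-norm ks)

bot-⇔ : ∀ {KK LL : Over ΣG} {x y} → WeakBisimilar KK LL x y → Bot KK x ⇔ Bot LL y
bot-⇔ (R , W , r) = mk⇔ (bot-transfer W r) (bot-transfer (converse W) r)

-- Modularity: ⊩^G is a weak bisimulation between G^⌣ and G^W, since each
-- edge on one side is matched by a single edge on the other (mod₂, mod₁)
-- with the same label (functionality of ⇓).

module Modularity (G : GC) (M : Modular G) where
  open Modular M

  Forces : V (Gr G ⊗ᴿ Gr G) → V (Gr G) → Set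
  Forces (a , b) z = RV G a b z

  private
    single : ∀ {l l'} → l ≡ l' → SameModId ΣG (l ∷ []) (l' ∷ [])
    single eq = norm⇒same (cong (λ l → norm (l ∷ [])) eq)

  isBisim : IsWeakBisim (ComplGraph G) (WGraph G) Forces
  isBisim = record
    { vert = λ { {a , b} {z} r → (z , r) , RV-W G r , refl }
    ; forth = forth
    ; back = back }
    where
    forth : ∀ {x z x'} → Forces x z → (e : E (K (ComplGraph G))) (pe : EK (ComplGraph G) e) →
            src (K (ComplGraph G)) e ≡ x' → tgt (K (ComplGraph G)) e ≡ x →
            Σ (V (Gr G)) λ z' → Σ (List Label) λ ls →
              Path (WGraph G) z' z ls × Forces x' z' × SameModId ΣG ls (lE (ComplGraph G) e pe ∷ [])
    forth r (ex , ey) (e , re) refl refl with mod₂ r ex ey refl refl (e , re)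
    ... | e₀ , t₀ , re₀ = src (Gr G) e₀ , _ , step e₀ (RE-W G re₀) refl t₀ nil , RE-src G re₀ ,
          single (⇓-functional G re₀ re (RE-W G re₀) (RE-W G re))

    back : ∀ {x z z'} → Forces x z → (e : E (Gr G)) (pe : WE G e) →
           src (Gr G) e ≡ z' → tgt (Gr G) e ≡ z →
           Σ (V (K (ComplGraph G))) λ x' → Σ (List Label) λ ls →
             Path (ComplGraph G) x' x ls × Forces x' z' × SameModId ΣG ls (ℓ G e pe ∷ [])
    back r e w refl refl with mod₁ r e w refl
    ... | ex , ey , tx , ty , re = (src (Gr G) ex , src (Gr G) ey) , _ ,
          step (ex , ey) (e , re) refl (cong₂ _,_ tx ty) nil , RE-src G re ,
          single (ℓ-irr G e (RE-W G re) w)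

modular-≈ : (G : GC) → Modular G → ∀ {x y z} → RV G x y z →
            WeakBisimilar (ComplGraph G) (WGraph G) (x , y) z
modular-≈ G M r = Modularity.Forces G M , Modularity.isBisim G M , r

ide-shape : (B : RGraph) {e : E B} → IsIde B e → e ≡ ide B (src B e) × src B e ≡ tgt B e
ide-shape B (v , refl) = cong (ide B) (sym (src-ide B v)) , trans (src-ide B v) (sym (tgt-ide B v))

⇓-cong : (A : GC) {a a' b b' : E (Gr A)} → a ≡ a' → b ≡ b' →
         (c : ComplE A a b) (c' : ComplE A a' b') → ⇓ A c ≡ ⇓ A c'
⇓-cong A refl refl (_ , r) (_ , r') = ⇓-functional A r r' (RE-W A r) (RE-W A r')

compl-src : (A : GC) {a b : E (Gr A)} → ComplE A a b → Compl A (src (Gr A) a) (src (Gr A) b)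
compl-src A (_ , r) = _ , RE-src A r

compl-tgt : (A : GC) {a b : E (Gr A)} → ComplE A a b → Compl A (tgt (Gr A) a) (tgt (Gr A) b)
compl-tgt A (_ , r) = _ , RE-tgt A r

ide-compl : (A : GC) {a b : V (Gr A)} → Compl A a b →
            Σ (ComplE A (ide (Gr A) a) (ide (Gr A) b)) λ c → ⇓ A c ≡ idL
ide-compl A (z , r) = (ide (Gr A) z , RV-ide A r) , ℓ-ide A z (RE-W A (RV-ide A r))

-- An edge (ex , eb) is simulated by pairing the
-- H₂-path answering eb with identities of G₁, except for its one
-- non-identity edge, which is paired with ex.

module BlindSimulation (A : GC) {G₁ H₁ H₂ : RGraph} (p : Hom G₁ (Gr A))
                  (q₁ : Hom H₁ (Gr A)) (q₂ : Hom H₂ (Gr A))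
                  (S : V H₁ → V H₂ → Set)
                  (SW : IsWeakBisim (OverHom q₁) (OverHom q₂) S) where

  -- the candidate bisimulation; complementarity of (a , b) is kept for `vert`
  Related : V (G₁ ⊗ᴿ H₁) → V (G₁ ⊗ᴿ H₂) → Set
  Related (a , b) (a' , c) = a ≡ a' × S b c × Compl A (fV p a) (fV q₁ b)

  S-vert : ∀ {b c} → S b c → fV q₁ b ≡ fV q₂ c
  S-vert s = proj₂ (proj₂ (IsWeakBisim.vert SW s))

  stay : ∀ a (h : E H₂) → IsIde (Gr A) (fE q₂ h) → Compl A (fV p a) (fV q₂ (src H₂ h)) →
         Σ (ComplE A (fE p (ide G₁ a)) (fE q₂ h)) λ c →
           ⇓ A c ≡ idL × Compl A (fV p a) (fV q₂ (tgt H₂ h))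
  stay a h isId cp = c , trans (⇓-cong A (f-ide p a) h≡ide c c₀) c₀-id ,
                     subst (Compl A (fV p a)) loop cp
    where
    h≡ide : fE q₂ h ≡ ide (Gr A) (fV q₂ (src H₂ h))
    h≡ide = trans (proj₁ (ide-shape (Gr A) isId)) (cong (ide (Gr A)) (f-src q₂ h))
    loop : fV q₂ (src H₂ h) ≡ fV q₂ (tgt H₂ h)
    loop = trans (sym (f-src q₂ h)) (trans (proj₂ (ide-shape (Gr A) isId)) (f-tgt q₂ h))
    c₀ = proj₁ (ide-compl A cp)
    c₀-id = proj₂ (ide-compl A cp)
    c : ComplE A (fE p (ide G₁ a)) (fE q₂ h)
    c = subst₂ (ComplE A) (sym (f-ide p a)) (sym h≡ide) c₀

  stay-step : ∀ {a c₀ c end ls} (h : E H₂) (c' : ComplE A (fE p (ide G₁ a)) (fE q₂ h)) →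
              src H₂ h ≡ c₀ → tgt H₂ h ≡ c → Path (Blind A p q₂) (a , c) end ls →
              Path (Blind A p q₂) (a , c₀) end (⇓ A c' ∷ ls)
  stay-step {a} h c' refl refl =
    step (ide G₁ a , h) c' (cong (_, _) (src-ide G₁ a)) (cong (_, _) (tgt-ide G₁ a))

  lift-ids : ∀ {a c₀ c ls} → Compl A (fV p a) (fV q₂ c₀) →
             Path (OverHom q₂) c₀ c ls → Del (Gr A) ls [] →
             Σ (List Label) λ ms → Path (Blind A p q₂) (a , c₀) (a , c) ms × norm ms ≡ []
  lift-ids cp nil [] = [] , nil , refl
  lift-ids {a} cp (step h _ refl refl P) (drop isId d) with stay a h isId cp
  ... | c' , c'-id , cp' with lift-ids cp' P d
  ... | ms , Q , nm = ⇓ A c' ∷ ms , stay-step h c' refl refl Q , trans (norm-prefix-id ms c'-id) nm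

  lift-edge : ∀ {a' a c₀ c ls f} (ex : E G₁) → src G₁ ex ≡ a' → tgt G₁ ex ≡ a →
              (ce : ComplE A (fE p ex) f) → Compl A (fV p a') (fV q₂ c₀) →
              Path (OverHom q₂) c₀ c ls → Del (Gr A) ls (f ∷ []) →
              Σ (List Label) λ ms →
                Path (Blind A p q₂) (a' , c₀) (a , c) ms × norm ms ≡ norm (⇓ A ce ∷ [])
  lift-edge {a'} ex sx tx ce cp (step h _ refl refl P) (drop isId d) with stay a' h isId cp
  ... | c' , c'-id , cp' with lift-edge ex sx tx ce cp' P d
  ... | ms , Q , nm = ⇓ A c' ∷ ms , stay-step h c' refl refl Q , trans (norm-prefix-id ms c'-id) nm
  lift-edge ex sx tx ce cp (step h _ refl refl P) (keep _ d)
    with lift-ids (subst₂ (Compl A) (trans (f-tgt p ex) (cong (fV p) tx)) (f-tgt q₂ h)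
                                     (compl-tgt A ce)) P d
  ... | ms , Q , nm = ⇓ A ce ∷ ms , step (ex , h) ce (cong (_, _) sx) (cong (_, _) tx) Q ,
                      norm-pad-right (⇓ A ce) ms nm

  lift-ids-then-edge : ∀ {a' a c₀ c ls} (ex : E G₁) → src G₁ ex ≡ a' → tgt G₁ ex ≡ a →
                       (ce : ComplE A (fE p ex) (fE q₂ (ide H₂ c))) →
                       Compl A (fV p a') (fV q₂ c₀) →
                       Path (OverHom q₂) c₀ c ls → Del (Gr A) ls [] →
                       Σ (List Label) λ ms →
                         Path (Blind A p q₂) (a' , c₀) (a , c) ms × norm ms ≡ norm (⇓ A ce ∷ [])
  lift-ids-then-edge {c = c} ex sx tx ce cp P d with lift-ids cp P d
  ... | ms , Q , nm = ms ++ ⇓ A ce ∷ [] ,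
        Q ++ᴾ step (ex , ide H₂ c) ce (cong₂ _,_ sx (src-ide H₂ c)) (cong₂ _,_ tx (tgt-ide H₂ c)) nil ,
        norm-pad-left _ ms nm

  -- the forth clause; the back clause is the forth clause for the converse of S
  forth : ∀ {x y x'} → Related x y → (e : E (G₁ ⊗ᴿ H₁)) (pe : EK (Blind A p q₁) e) →
          src (G₁ ⊗ᴿ H₁) e ≡ x' → tgt (G₁ ⊗ᴿ H₁) e ≡ x →
          Σ (V (G₁ ⊗ᴿ H₂)) λ y' → Σ (List Label) λ ls →
            Path (Blind A p q₂) y' y ls × Related x' y' × SameModId ΣG ls (⇓ A pe ∷ [])
  forth {y = _ , c} (refl , s , _) (ex , eb) ce refl refl
    with IsWeakBisim.forth SW s eb tt refl refl
  ... | c' , ls , P , s' , (zs , d₁ , d₂) = answer d₂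
    where
    cp-src : Compl A (fV p (src G₁ ex)) (fV q₁ (src H₁ eb))
    cp-src = subst₂ (Compl A) (f-src p ex) (f-src q₁ eb) (compl-src A ce)
    cp-start : Compl A (fV p (src G₁ ex)) (fV q₂ c')
    cp-start = subst (Compl A (fV p (src G₁ ex))) (S-vert s') cp-src
    answer : Del (Gr A) (fE q₁ eb ∷ []) zs →
             Σ (V (G₁ ⊗ᴿ H₂)) λ y' → Σ (List Label) λ ls →
               Path (Blind A p q₂) y' (tgt G₁ ex , c) ls ×
               Related (src G₁ ex , src H₁ eb) y' × SameModId ΣG ls (⇓ A ce ∷ [])
    -- eb lies over an identity, hence over the identity at c
    answer (drop isId []) =
      let (ms , Q , nm) = lift-ids-then-edge ex refl refl ce' cp-start P d₁
      in (src G₁ ex , c') , ms , Q , (refl , s' , cp-src) ,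
         norm⇒same (trans nm (cong (λ l → norm (l ∷ [])) (⇓-cong A refl (sym eb≡) ce' ce)))
      where
      eb≡ : fE q₁ eb ≡ fE q₂ (ide H₂ c)
      eb≡ = begin
        fE q₁ eb                               ≡⟨ proj₁ (ide-shape (Gr A) isId) ⟩
        ide (Gr A) (src (Gr A) (fE q₁ eb))     ≡⟨ cong (ide (Gr A)) (proj₂ (ide-shape (Gr A) isId)) ⟩
        ide (Gr A) (tgt (Gr A) (fE q₁ eb))     ≡⟨ cong (ide (Gr A)) (trans (f-tgt q₁ eb) (S-vert s)) ⟩
        ide (Gr A) (fV q₂ c)                   ≡⟨ f-ide q₂ c ⟨
        fE q₂ (ide H₂ c)                       ∎
        where open ≡-Reasoning
      ce' : ComplE A (fE p ex) (fE q₂ (ide H₂ c))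
      ce' = subst (ComplE A (fE p ex)) eb≡ ce
    -- eb lies over a non-identity: its answer contains one matching edge
    answer (keep _ []) with lift-edge ex refl refl ce cp-start P d₁
    ... | ms , Q , nm = (src G₁ ex , c') , ms , Q , (refl , s' , cp-src) , norm⇒same nm

blind-≈ : (A : GC) {G₁ H₁ H₂ : RGraph} (p : Hom G₁ (Gr A))
          (q₁ : Hom H₁ (Gr A)) (q₂ : Hom H₂ (Gr A)) {a : V G₁} {b : V H₁} {c : V H₂} →
          WeakBisimilar (OverHom q₁) (OverHom q₂) b c → Compl A (fV p a) (fV q₁ b) →
          WeakBisimilar (Blind A p q₁) (Blind A p q₂) (a , b) (a , c)
blind-≈ A p q₁ q₂ (S , SW , s) cp = Related , isBisim , (refl , s , cp)
  where
  open BlindSimulation A p q₁ q₂ S SW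
  module Back = BlindSimulation A p q₂ q₁ (λ c b → S b c) (converse SW)

  swap : ∀ {a b a' c} → Related (a , b) (a' , c) → Back.Related (a' , c) (a , b)
  swap (refl , s , cp) = refl , s , subst (Compl A _) (S-vert s) cp

  unswap : ∀ {a b a' c} → Back.Related (a' , c) (a , b) → Related (a , b) (a' , c)
  unswap (refl , s , cp) = refl , s , subst (Compl A _) (sym (S-vert s)) cp

  isBisim : IsWeakBisim (Blind A p q₁) (Blind A p q₂) Related
  isBisim = record
    { vert = λ { {_ , _} {_ , _} r → proj₂ (proj₂ r) , proj₂ (proj₂ (swap r)) , refl }
    ; forth = forth
    ; back = λ { {_ , _} {_ , _} {_ , _} r e pe st tg →
                 let (x' , ls , P , r' , same) = Back.forth (swap r) e pe st tg
                 in x' , ls , P , unswap r' , same } }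

proposition6p34 : (A G : GC) (H : RGraph) (p : GCHom G A) (q : Hom H (Gr A)) →
    Modular G → Adequate G A p →
    (x₁ x₂ z : V (Gr G)) (y : V H) →
    Compl G x₁ x₂ → RV G x₁ x₂ z →
    WeakBisimilar (OverHom (hom p)) (OverHom q) x₂ y →
    Bot (WGraph G) z ⇔ Bot (Blind A (hom p) q) (x₁ , y)
proposition6p34 A G H p q M Ad x₁ x₂ z y x₁⌣x₂ r x₂≈y =
  ⇔.trans (bot-⇔ z≈x) (⇔.trans (bot-⇔ x≈x) (bot-⇔ x≈y))
  where
  open Adequate Ad
  z≈x : WeakBisimilar (WGraph G) (ComplGraph G) z (x₁ , x₂)
  z≈x = ≈-sym (modular-≈ G M r)
  x≈x : WeakBisimilar (ComplGraph G) (Blind A (hom p) (hom p)) (x₁ , x₂) (x₁ , x₂)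
  x≈x = adeq-a x₁ x₂ x₁⌣x₂
  x≈y : WeakBisimilar (Blind A (hom p) (hom p)) (Blind A (hom p) q) (x₁ , x₂) (x₁ , y)
  x≈y = blind-≈ A (hom p) (hom p) q x₂≈y (Equivalence.to (adeq-b x₁ x₂) x₁⌣x₂)
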